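{- Let $M$ be an $F$-space. If $G$ is an infinite subgroup of $M$, then $G$ is not a groupless $F$-set.
   Context: $R=\mathbb{Z}[F]$ is a unital ring generated over $\mathbb{Z}$ by $F$; an $F$-space is a finitely generated $R$-module $M$ with $\bigcap_{n\ge0}F^nM$ finite. $\mathbb{N}_*=\mathbb{N}\cup\{ -\infty\}$ with $F^{ -\infty}a=0$. A basic groupless $F$-set is $S(\overline{a};\overline{\delta})=\{\sum_iF^{\delta_im_i}a_i:\overline{m}\in\mathbb{N}_*^n\}$ for a tuple $\overline{a}$ from $M$ and positive integers $\delta_i$; a groupless $F$-set is a finite union of translates of basic groupless $F$-sets. -}

module Defs where

open import Level using (Level; _⊔_)
open import Data.Nat using (ℕ; zero; suc; _<_) renaming (_*_ to _*ℕ_)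
open import Data.Integer using (ℤ; +_; -[1+_])
open import Data.Fin using (Fin)
open import Data.List using (List; []; _∷_)
open import Data.List.Relation.Unary.Any using (Any)
open import Data.Maybe using (Maybe; just; nothing)
open import Data.Product using (Σ; ∃; _×_; _,_)
open import Relation.Nullary using (¬_)
open import Function.Bundles using (_⇔_)
open import Algebra.Bundles using (Ring)
open import Algebra.Module.Bundles using (LeftModule)

module RingPow {r ℓ : Level} (R : Ring r ℓ) where
  open Ring R
  pow : Carrier → ℕ → Carrier
  pow x zero = 1#
  pow x (suc n) = x * pow x n

  natR : ℕ → Carrier
  natR zero = 0#
  natR (suc n) = 1# + natR n

  intR : ℤ → Carrier
  intR (+ n) = natR n
  intR (-[1+ n ]) = - natR (suc n)

  evalPoly : Carrier → List ℤ → Carrier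
  evalPoly x [] = 0#
  evalPoly x (c ∷ cs) = intR c + x * evalPoly x cs

open RingPow public

-- R = ℤ[F]: the unital ring R is generated over ℤ by the element F,
-- i.e. every element of R is an integer polynomial in F.
GeneratedBy : {r ℓ : Level} (R : Ring r ℓ) → Ring.Carrier R → Set (r ⊔ ℓ)
GeneratedBy R F = ∀ (x : Ring.Carrier R) → ∃ λ (cs : List ℤ) → Ring._≈_ R x (evalPoly R F cs)

module ModuleDefs {r ℓr m ℓm : Level} {R : Ring r ℓr} (F : Ring.Carrier R)
                  (M : LeftModule R m ℓm) where
  open Ring R using (Carrier)
  open LeftModule M

  sumᴹ : (n : ℕ) → (Fin n → Carrierᴹ) → Carrierᴹ
  sumᴹ zero f = 0ᴹ
  sumᴹ (suc n) f = f Fin.zero +ᴹ sumᴹ n (λ i → f (Fin.suc i))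
    where import Data.Fin as Fin

  FinitelyGenerated : Set (r ⊔ m ⊔ ℓm)
  FinitelyGenerated =
    Σ ℕ λ k → Σ (Fin k → Carrierᴹ) λ g →
      ∀ (x : Carrierᴹ) → Σ (Fin k → Carrier) λ c → x ≈ᴹ sumᴹ k (λ i → c i *ₗ g i)

  FiniteSubset : {p : Level} → (Carrierᴹ → Set p) → Set (m ⊔ ℓm ⊔ p)
  FiniteSubset P = Σ (List Carrierᴹ) λ L → ∀ x → P x → Any (x ≈ᴹ_) L

  InAllFPowers : Carrierᴹ → Set (m ⊔ ℓm)
  InAllFPowers x = ∀ (n : ℕ) → Σ Carrierᴹ λ y → x ≈ᴹ (pow R F n *ₗ y)

  IsFSpace : Set (r ⊔ m ⊔ ℓm)
  IsFSpace = FinitelyGenerated × FiniteSubset InAllFPowers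

  record IsSubgroup {g : Level} (G : Carrierᴹ → Set g) : Set (m ⊔ ℓm ⊔ g) where
    field
      resp : ∀ {x y} → x ≈ᴹ y → G x → G y
      has-0 : G 0ᴹ
      +-closed : ∀ {x y} → G x → G y → G (x +ᴹ y)
      neg-closed : ∀ {x} → G x → G (-ᴹ x)

  Infinite : {p : Level} → (Carrierᴹ → Set p) → Set (m ⊔ ℓm ⊔ p)
  Infinite P = ¬ FiniteSubset P

  -- F^{δ m} a, with F^{-∞} a = 0 (m = nothing encodes -∞)
  fTerm : ℕ → Maybe ℕ → Carrierᴹ → Carrierᴹ
  fTerm δ nothing a = 0ᴹ
  fTerm δ (just k) a = pow R F (δ *ℕ k) *ₗ a

  record BasicData : Set m where
    field
      n : ℕ
      a : Fin n → Carrierᴹ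
      δ : Fin n → ℕ
      δ-pos : ∀ i → 0 < δ i

  -- membership in S(ā; δ̄) = { Σᵢ F^{δᵢ mᵢ} aᵢ : m̄ ∈ ℕ_*ⁿ }
  InBasic : BasicData → Carrierᴹ → Set ℓm
  InBasic D x = Σ (Fin n → Maybe ℕ) λ mm → x ≈ᴹ sumᴹ n (λ i → fTerm (δ i) (mm i) (a i))
    where open BasicData D

  IsGrouplessFSet : {g : Level} → (Carrierᴹ → Set g) → Set (m ⊔ ℓm ⊔ g)
  IsGrouplessFSet G =
    Σ ℕ λ t → Σ (Fin t → Carrierᴹ) λ b → Σ (Fin t → BasicData) λ D →
      ∀ x → G x ⇔ (Σ (Fin t) λ j → Σ Carrierᴹ λ y → InBasic (D j) y × x ≈ᴹ (b j +ᴹ y))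

open ModuleDefs public

-- Write G = ⋃ⱼ (bⱼ + S(āⱼ; δ̄ⱼ)), let Δ be a common multiple of all the δ's, y = F^Δ, and let H be the
-- ℤ[y]-submodule generated by the terms F^(δ k)·a of the basic sets. Multiplying such a term by y gives
-- another one, so yⁿH ⊆ G for all n; and modulo yⁿH every element of G agrees with one of at most
-- t·(1 + nΔ)^W elements, obtained by dropping the terms with δ k ≥ nΔ (they lie in yⁿH).
-- If yᵏH = yᵏ⁺¹H for some k, then yᵏH ⊆ ⋂ Fⁿ M is finite, hence so is G. Otherwise choose
-- hₖ ∈ yᵏH ∖ yᵏ⁺¹H: the 2ⁿ subset sums of h₀, …, hₙ₋₁ lie in H ⊆ G and are pairwise incongruent
-- modulo yⁿH, contradicting the polynomial bound for large n.
-- Constructively this case split only holds under double negation, which is enough as the goal is ⊥: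
-- whether yᵏH = yᵏ⁺¹H only needs checking on the finitely many generators F^(δ r)·a with r < Δ/δ.

{-# OPTIONS --safe #-}
module Submission where

open import Defs
open import Level using (Level; _⊔_)
open import Relation.Nullary using (¬_; yes; no; contradiction)
open import Algebra.Bundles using (Ring; AbelianGroup)
open import Algebra.Module.Bundles using (LeftModule)

open import Data.Nat
  using (ℕ; zero; suc; _+_; _*_; _∸_; _^_; _≤_; _<_; _≤′_; ≤′-refl; ≤′-step; z≤n; s≤s; z<s;
         NonZero; >-nonZero; _<?_)
open import Data.Nat.Properties
open import Data.Nat.Solver using (module +-*-Solver)
open import Data.Nat.Divisibility using (_∣_; ∣-trans; quotient≢0; m∣n⇒n≡quotient*m)
open import Data.Nat.DivMod using (_/_; m≡m%n+[m/n]*n; m%n<n)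
open import Data.Nat.ListAction using (product)
open import Data.Nat.ListAction.Properties using (∈⇒∣product; product≢0)
open import Data.Fin
  using (Fin; zero; suc; toℕ; fromℕ<; inject≤; quotient; remainder; combine; finToFun; funToFin)
open import Data.Fin.Properties
  using (toℕ-inject≤; toℕ<n; fromℕ<-cong; fromℕ<-toℕ; toℕ-fromℕ<; pigeonhole;
         combine-remQuot; remQuot-combine; finToFun-funToFin)
  renaming (<-irrefl to <-irreflᶠ)
open import Data.List using (tabulate; map; allFin; cartesianProductWith)
import Data.List.Relation.Unary.All.Properties as All
open import Data.List.Membership.Propositional using (find; lose)
open import Data.List.Membership.Propositional.Properties
  using (∈-tabulate⁺; ∈-map⁺; ∈-allFin; ∈-cartesianProductWith⁺)
open import Data.Maybe using (Maybe; just; nothing)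
open import Data.Product using (Σ; Σ-syntax; ∃-syntax; ∃₂; _×_; _,_; proj₁; proj₂)
open import Function.Bundles using (_⇔_; Equivalence)
open import Relation.Binary.PropositionalEquality as ≡ using (_≡_)

n<2^n : ∀ n → n < 2 ^ n
n<2^n zero    = z<s
n<2^n (suc n) = begin-strict
  suc n           ≡⟨ +-comm 1 n ⟩
  n + 1           <⟨ +-mono-≤ (n<2^n n) (m^n>0 2 n) ⟩
  2 ^ n + 2 ^ n   ≡⟨ ≡.cong (2 ^ n +_) (+-identityʳ (2 ^ n)) ⟨
  2 ^ suc n       ∎
  where open ≤-Reasoning

linear<2^ : ∀ a b → ∃[ s ] a + s * b < 2 ^ s
linear<2^ a b = k + k , (begin-strict
  a + (k + k) * b          ≤⟨ +-monoˡ-≤ ((k + k) * b) (m≤n*m a k) ⟩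
  k * a + (k + k) * b      <⟨ m<n+m _ {k} z<s ⟩
  k + (k * a + (k + k) * b) ≡⟨ square ⟨
  k * k                    <⟨ *-mono-< (n<2^n k) (n<2^n k) ⟩
  2 ^ k * 2 ^ k            ≡⟨ ^-distribˡ-+-* 2 k k ⟨
  2 ^ (k + k)              ∎)
  where
  open ≤-Reasoning
  open +-*-Solver
  k : ℕ
  k = suc (a + (b + b))
  square : k * k ≡ k + (k * a + (k + k) * b)
  square = solve 2 (λ a b → let k = con 1 :+ (a :+ (b :+ b)) in k :* k := k :+ (k :* a :+ (k :+ k) :* b))
                   ≡.refl a b

polynomial<2^ : ∀ c d e → ∃[ n ] c * suc (n * d) ^ e < 2 ^ n
polynomial<2^ c d e with linear<2^ (c + d * e) e
... | s , small = 2 ^ s , (begin-strict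
  c * suc (2 ^ s * d) ^ e         ≤⟨ *-mono-≤ (<⇒≤ (n<2^n c)) (^-monoˡ-≤ e base≤) ⟩
  2 ^ c * (2 ^ (s + d)) ^ e       ≡⟨ ≡.cong (2 ^ c *_) (^-*-assoc 2 (s + d) e) ⟩
  2 ^ c * 2 ^ ((s + d) * e)       ≡⟨ ^-distribˡ-+-* 2 c _ ⟨
  2 ^ (c + (s + d) * e)           <⟨ ^-monoʳ-< 2 (s≤s (s≤s z≤n)) (≡.subst (_< 2 ^ s) regroup small) ⟩
  2 ^ (2 ^ s)                     ∎)
  where
  open ≤-Reasoning
  open +-*-Solver
  regroup : c + d * e + s * e ≡ c + (s + d) * e
  regroup = solve 4 (λ c d s e → c :+ d :* e :+ s :* e := c :+ (s :+ d) :* e) ≡.refl c d s e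
  base≤ : suc (2 ^ s * d) ≤ 2 ^ (s + d)
  base≤ = begin
    suc (2 ^ s * d)      ≤⟨ +-monoˡ-≤ (2 ^ s * d) (m^n>0 2 s) ⟩
    2 ^ s + 2 ^ s * d    ≡⟨ *-suc (2 ^ s) d ⟨
    2 ^ s * suc d        ≤⟨ *-monoʳ-≤ (2 ^ s) (n<2^n d) ⟩
    2 ^ s * 2 ^ d        ≡⟨ ^-distribˡ-+-* 2 s d ⟨
    2 ^ (s + d)          ∎

common-multiple : ∀ {n} (f : Fin n → ℕ) → (∀ i → NonZero (f i)) → Σ[ m ∈ ℕ ] NonZero m × (∀ i → f i ∣ m)
common-multiple f f≢0 =
  product (tabulate f) , product≢0 (All.tabulate⁺ f≢0) , λ i → ∈⇒∣product (∈-tabulate⁺ i)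

upper-bound : ∀ {n} (f : Fin n → ℕ) → Σ[ m ∈ ℕ ] (∀ i → f i ≤ m)
upper-bound {zero}  f = 0 , λ ()
upper-bound {suc n} f with upper-bound (λ i → f (suc i))
... | m , bound = f zero + m , λ
  { zero    → m≤m+n (f zero) m
  ; (suc i) → ≤-trans (bound i) (m≤n+m m (f zero)) }

padTo : ∀ {a} {A : Set a} {n w} → n ≤ w → A → (Fin n → A) → Fin w → A
padTo {n = n} n≤w default f k with toℕ k <? n
... | yes k<n = f (fromℕ< k<n)
... | no  _   = default

padTo-inject≤ : ∀ {a} {A : Set a} {n w} (n≤w : n ≤ w) default (f : Fin n → A) i →
                padTo n≤w default f (inject≤ i n≤w) ≡ f i
padTo-inject≤ {n = n} n≤w default f i with toℕ (inject≤ i n≤w) <? n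
... | yes k<n =
  ≡.cong f (≡.trans (fromℕ<-cong _ _ (toℕ-inject≤ i n≤w) k<n (toℕ<n i)) (fromℕ<-toℕ i (toℕ<n i)))
... | no  k≮n = contradiction (≡.subst (_< n) (≡.sym (toℕ-inject≤ i n≤w)) (toℕ<n i)) k≮n

¬¬-∀Fin : ∀ {q n} {Q : Fin n → Set q} → (∀ i → ¬ ¬ Q i) → ¬ ¬ (∀ i → Q i)
¬¬-∀Fin {n = zero}      ¬¬Q ¬∀Q = ¬∀Q λ ()
¬¬-∀Fin {n = suc n} {Q} ¬¬Q ¬∀Q = ¬¬Q zero λ Q₀ → ¬¬-∀Fin (λ i → ¬¬Q (suc i)) λ Qₛ → ¬∀Q λ
  { zero    → Q₀
  ; (suc i) → Qₛ i }

module _ {r ℓr : Level} (R : Ring r ℓr) where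
  open Ring R using (_≈_; semiring) renaming (_*_ to _*ᴿ_)
  open import Algebra.Properties.Semiring.Exp semiring using (^-homo-*) renaming (_^_ to _^ᴿ_)

  pow≡^ : ∀ x n → pow R x n ≡ x ^ᴿ n
  pow≡^ x zero    = ≡.refl
  pow≡^ x (suc n) = ≡.cong (x *ᴿ_) (pow≡^ x n)

  pow-+ : ∀ x a b → pow R x (a + b) ≈ pow R x a *ᴿ pow R x b
  pow-+ x a b rewrite pow≡^ x (a + b) | pow≡^ x a | pow≡^ x b = ^-homo-* x a b

module _ {r ℓr m ℓm : Level} {R : Ring r ℓr} (M : LeftModule R m ℓm) where
  open LeftModule M

  pow-+-*ₗ : ∀ x a b u → pow R x (a + b) *ₗ u ≈ᴹ pow R x a *ₗ (pow R x b *ₗ u)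
  pow-+-*ₗ x a b u = ≈ᴹ-trans (*ₗ-congʳ (pow-+ R x a b)) (*ₗ-assoc _ _ u)

  *ₗ-neg : ∀ c x → c *ₗ (-ᴹ x) ≈ᴹ -ᴹ (c *ₗ x)
  *ₗ-neg c x = inverseʳ-unique (c *ₗ x) (c *ₗ (-ᴹ x)) (begin
    c *ₗ x +ᴹ c *ₗ (-ᴹ x)   ≈⟨ *ₗ-distribˡ c x (-ᴹ x) ⟨
    c *ₗ (x +ᴹ -ᴹ x)        ≈⟨ *ₗ-congˡ (-ᴹ‿inverseʳ x) ⟩
    c *ₗ 0ᴹ                 ≈⟨ *ₗ-zeroʳ c ⟩
    0ᴹ                      ∎)
    where
    open import Algebra.Properties.AbelianGroup +ᴹ-abelianGroup using (inverseʳ-unique)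
    open import Relation.Binary.Reasoning.Setoid ≈ᴹ-setoid

module _ {r ℓr m ℓm : Level} {R : Ring r ℓr} (F : Ring.Carrier R) (M : LeftModule R m ℓm) where
  open LeftModule M

  sumᴹ-cong : ∀ n {f f′ : Fin n → Carrierᴹ} → (∀ i → f i ≈ᴹ f′ i) → sumᴹ F M n f ≈ᴹ sumᴹ F M n f′
  sumᴹ-cong zero    f≈f′ = ≈ᴹ-refl
  sumᴹ-cong (suc n) f≈f′ = +ᴹ-cong (f≈f′ zero) (sumᴹ-cong n (λ i → f≈f′ (suc i)))

  sumᴹ-0ᴹ : ∀ n → sumᴹ F M n (λ _ → 0ᴹ) ≈ᴹ 0ᴹ
  sumᴹ-0ᴹ zero    = ≈ᴹ-refl
  sumᴹ-0ᴹ (suc n) = ≈ᴹ-trans (+ᴹ-identityˡ _) (sumᴹ-0ᴹ n)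

  single : ∀ {n} → Fin n → ℕ → Fin n → Maybe ℕ
  single zero    k zero    = just k
  single zero    k (suc _) = nothing
  single (suc i) k zero    = nothing
  single (suc i) k (suc j) = single i k j

  sumᴹ-single : ∀ {n} (f : Fin n → Maybe ℕ → Carrierᴹ) → (∀ i → f i nothing ≈ᴹ 0ᴹ) →
                ∀ i k → sumᴹ F M n (λ j → f j (single i k j)) ≈ᴹ f i (just k)
  sumᴹ-single {suc n} f f-nothing zero k =
    ≈ᴹ-trans (+ᴹ-congˡ (≈ᴹ-trans (sumᴹ-cong n (λ i → f-nothing (suc i))) (sumᴹ-0ᴹ n))) (+ᴹ-identityʳ _)
  sumᴹ-single {suc n} f f-nothing (suc i) k =
    ≈ᴹ-trans (+ᴹ-cong (f-nothing zero) (sumᴹ-single (λ j → f (suc j)) (λ j → f-nothing (suc j)) i k))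
             (+ᴹ-identityˡ _)

  FiniteSubset-+ : ∀ {p q s} {A : Carrierᴹ → Set p} {B : Carrierᴹ → Set q} {S : Carrierᴹ → Set s} →
                   FiniteSubset F M A → FiniteSubset F M B →
                   (∀ x → S x → ∃₂ λ u v → A u × B v × x ≈ᴹ u +ᴹ v) → FiniteSubset F M S
  FiniteSubset-+ (us , A⊆us) (vs , B⊆vs) S⊆A+B = cartesianProductWith _+ᴹ_ us vs , λ x x∈S →
    let u , v , u∈A , v∈B , x≈u+v = S⊆A+B x x∈S
        u′ , u′∈us , u≈u′ = find (A⊆us u u∈A)
        v′ , v′∈vs , v≈v′ = find (B⊆vs v v∈B)
    in lose (∈-cartesianProductWith⁺ _+ᴹ_ u′∈us v′∈vs) (≈ᴹ-trans x≈u+v (+ᴹ-cong u≈u′ v≈v′))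

  image-finite : ∀ {n} (f : Fin n → Carrierᴹ) → FiniteSubset F M (λ x → ∃[ i ] x ≈ᴹ f i)
  image-finite f = map f (allFin _) , λ { x (i , x≈fi) → lose (∈-map⁺ f (∈-allFin i)) x≈fi }

record IsDescendingChain {a ℓ p : Level} (A : AbelianGroup a ℓ)
                         (P : ℕ → AbelianGroup.Carrier A → Set p) : Set (a ⊔ ℓ ⊔ p) where
  open AbelianGroup A
  field
    P-resp : ∀ {n x y} → x ≈ y → P n x → P n y
    P-ε    : ∀ {n} → P n ε
    P-∙    : ∀ {n x y} → P n x → P n y → P n (x ∙ y)
    P-⁻¹   : ∀ {n x} → P n x → P n (x ⁻¹)
    P-suc  : ∀ {n x} → P (suc n) x → P n x

module DescendingChain {a ℓ p : Level} (A : AbelianGroup a ℓ) {P : ℕ → AbelianGroup.Carrier A → Set p}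
                       (chain : IsDescendingChain A P) where

  open AbelianGroup A
  open IsDescendingChain chain
  open import Algebra.Properties.AbelianGroup A
  open import Algebra.Properties.CommutativeSemigroup commutativeSemigroup using (interchange)
  open import Relation.Binary.Reasoning.Setoid setoid

  private variable
    k L m n N : ℕ
    c u x x′ y y′ z : Carrier

  infix 4 _∼[_]_
  _∼[_]_ : Carrier → ℕ → Carrier → Set p
  x ∼[ n ] y = P n (x - y)

  ∼-refl : x ∼[ n ] x
  ∼-refl = P-resp (sym (x≈y⇒x∙y⁻¹≈ε refl)) P-ε

  ∼-sym : x ∼[ n ] y → y ∼[ n ] x
  ∼-sym {x} {y = y} x∼y = P-resp (⁻¹-anti-homo‿- x y) (P-⁻¹ x∼y)

  ∼-trans : x ∼[ n ] y → y ∼[ n ] z → x ∼[ n ] z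
  ∼-trans {x} {y = y} {z} x∼y y∼z = P-resp telescope (P-∙ x∼y y∼z)
    where
    telescope : (x - y) ∙ (y - z) ≈ x - z
    telescope = begin
      x ∙ y ⁻¹ ∙ (y ∙ z ⁻¹)    ≈⟨ assoc x (y ⁻¹) (y ∙ z ⁻¹) ⟩
      x ∙ (y ⁻¹ ∙ (y ∙ z ⁻¹))  ≈⟨ ∙-congˡ (\\-leftDividesʳ y (z ⁻¹)) ⟩
      x ∙ z ⁻¹                 ∎

  ∼-resp : x ≈ x′ → y ≈ y′ → x ∼[ n ] y → x′ ∼[ n ] y′
  ∼-resp x≈x′ y≈y′ = P-resp (//-cong₂ x≈x′ y≈y′)

  ∼-∙ : x ∼[ n ] y → x′ ∼[ n ] y′ → x ∙ x′ ∼[ n ] y ∙ y′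
  ∼-∙ {x} {y = y} {x′} {y′} x∼y x′∼y′ = P-resp distribute (P-∙ x∼y x′∼y′)
    where
    distribute : (x - y) ∙ (x′ - y′) ≈ (x ∙ x′) - (y ∙ y′)
    distribute = begin
      x ∙ y ⁻¹ ∙ (x′ ∙ y′ ⁻¹)   ≈⟨ interchange x (y ⁻¹) x′ (y′ ⁻¹) ⟩
      x ∙ x′ ∙ (y ⁻¹ ∙ y′ ⁻¹)   ≈⟨ ∙-congˡ (⁻¹-∙-comm y y′) ⟩
      x ∙ x′ ∙ (y ∙ y′) ⁻¹      ∎

  ∼-≤ : m ≤ n → x ∼[ n ] y → x ∼[ m ] y
  ∼-≤ m≤n = go (≤⇒≤′ m≤n)
    where
    go : m ≤′ n → P n z → P m z
    go ≤′-refl        z∈ = z∈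
    go (≤′-step m≤′n) z∈ = go m≤′n (P-suc z∈)

  ∼-cancelˡ : c ∙ x ∼[ n ] c ∙ y → x ∼[ n ] y
  ∼-cancelˡ {c} {x} {y = y} cx∼cy =
    ∼-resp (\\-leftDividesʳ c x) (\\-leftDividesʳ c y) (∼-∙ (∼-refl {x = c ⁻¹}) cx∼cy)

  x-ε≈x : x - ε ≈ x
  x-ε≈x {x} = trans (∙-congˡ ε⁻¹≈ε) (identityʳ x)

  ∈⇒∼ε : P n x → x ∼[ n ] ε
  ∈⇒∼ε = P-resp (sym x-ε≈x)

  ∼ε⇒∈ : x ∼[ n ] ε → P n x
  ∼ε⇒∈ = P-resp x-ε≈x

  ∙-absorbʳ : P n u → x ∙ u ∼[ n ] x
  ∙-absorbʳ {x = x} u∈ = ∼-resp refl (identityʳ x) (∼-∙ ∼-refl (∈⇒∼ε u∈))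

  Gap : ℕ → Set (a ⊔ p)
  Gap k = Σ[ x ∈ Carrier ] P k x × ¬ P (suc k) x

  infixr 5 _∷_
  data Gaps : ℕ → ℕ → Set (a ⊔ p) where
    []  : Gaps k zero
    _∷_ : Gap k → Gaps (suc k) L → Gaps k (suc L)

  ¬¬-gaps : (∀ k → ¬ ¬ Gap k) → ∀ k L → ¬ ¬ Gaps k L
  ¬¬-gaps gap k zero    ¬gaps = ¬gaps []
  ¬¬-gaps gap k (suc L) ¬gaps = gap k λ g → ¬¬-gaps gap (suc k) L λ gs → ¬gaps (g ∷ gs)

  select : Fin 2 → Carrier → Carrier
  select zero       x = ε
  select (suc zero) x = x

  subsetSum : Gaps k L → Fin (2 ^ L) → Carrier
  subsetSum []                      i = ε
  subsetSum {L = suc L} ((x , _) ∷ gs) i =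
    select (quotient (2 ^ L) i) x ∙ subsetSum gs (remainder {2} (2 ^ L) i)

  select∈P : (b : Fin 2) → P k x → P k (select b x)
  select∈P zero       x∈ = P-ε
  select∈P (suc zero) x∈ = x∈

  subsetSum∈P : (gs : Gaps k L) (i : Fin (2 ^ L)) → P k (subsetSum gs i)
  subsetSum∈P []                    i = P-ε
  subsetSum∈P {L = suc L} ((x , x∈ , _) ∷ gs) i =
    P-∙ (select∈P (quotient (2 ^ L) i) x∈) (P-suc (subsetSum∈P gs (remainder {2} (2 ^ L) i)))

  select-injective : ¬ P (suc k) x → ∀ b b′ → select b x ∼[ suc k ] select b′ x → b ≡ b′
  select-injective x∉ zero       zero       _  = ≡.refl
  select-injective x∉ (suc zero) (suc zero) _  = ≡.refl
  select-injective x∉ zero       (suc zero) ε∼x = contradiction (∼ε⇒∈ (∼-sym ε∼x)) x∉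
  select-injective x∉ (suc zero) zero       x∼ε = contradiction (∼ε⇒∈ x∼ε) x∉

  subsetSum-injective : (gs : Gaps k L) (i j : Fin (2 ^ L)) →
                        subsetSum gs i ∼[ k + L ] subsetSum gs j → i ≡ j
  subsetSum-injective [] zero zero _ = ≡.refl
  subsetSum-injective {k} {suc L} ((x , _ , x∉) ∷ gs) i j sᵢ∼sⱼ = i≡j
    where
    shift : suc k + L ≤ k + suc L
    shift = ≤-reflexive (≡.sym (+-suc k L))
    bᵢ = quotient (2 ^ L) i
    bⱼ = quotient (2 ^ L) j
    rᵢ = remainder {2} (2 ^ L) i
    rⱼ = remainder {2} (2 ^ L) j
    heads : select bᵢ x ∼[ suc k ] select bⱼ x
    heads = ∼-trans (∼-sym (∙-absorbʳ (subsetSum∈P gs rᵢ)))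
              (∼-trans (∼-≤ (≤-trans (m≤m+n (suc k) L) shift) sᵢ∼sⱼ) (∙-absorbʳ (subsetSum∈P gs rⱼ)))
    bᵢ≡bⱼ : bᵢ ≡ bⱼ
    bᵢ≡bⱼ = select-injective x∉ bᵢ bⱼ heads
    tails : subsetSum gs rᵢ ∼[ suc k + L ] subsetSum gs rⱼ
    tails = ∼-≤ shift (∼-cancelˡ
      (≡.subst (λ b → _ ∼[ k + suc L ] select b x ∙ subsetSum gs rⱼ) (≡.sym bᵢ≡bⱼ) sᵢ∼sⱼ))
    i≡j : i ≡ j
    i≡j = ≡.trans (≡.sym (combine-remQuot {2} (2 ^ L) i))
               (≡.trans (≡.cong₂ combine bᵢ≡bⱼ (subsetSum-injective gs rᵢ rⱼ tails))
                 (combine-remQuot {2} (2 ^ L) j))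

  CosetCover : ∀ {q} → (Carrier → Set q) → ℕ → ℕ → Set (a ⊔ p ⊔ q)
  CosetCover Q n N = Σ[ rep ∈ (Fin N → Carrier) ] ∀ {x} → Q x → ∃[ i ] x ∼[ n ] rep i

  gaps⇒2^n≤cover : Gaps 0 n → CosetCover (P 0) n N → 2 ^ n ≤ N
  gaps⇒2^n≤cover {n} gs (rep , cover) = ≮⇒≥ λ N<2ⁿ →
    let i , j , i<j , same-coset = pigeonhole N<2ⁿ coset in
    <-irreflᶠ (subsetSum-injective gs i j (sᵢ∼sⱼ i j same-coset)) i<j
    where
    coset : Fin (2 ^ n) → Fin _
    coset i = proj₁ (cover (subsetSum∈P gs i))
    sᵢ∼sⱼ : ∀ i j → coset i ≡ coset j → subsetSum gs i ∼[ n ] subsetSum gs j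
    sᵢ∼sⱼ i j same = ∼-trans (proj₂ (cover (subsetSum∈P gs i)))
      (≡.subst (λ c → rep c ∼[ n ] subsetSum gs j) (≡.sym same) (∼-sym (proj₂ (cover (subsetSum∈P gs j)))))

module CyclicSpan {r ℓr m ℓm i : Level} {R : Ring r ℓr} (M : LeftModule R m ℓm)
  (y : Ring.Carrier R) {I : Set i} (g : I → LeftModule.Carrierᴹ M) where

  open LeftModule M

  private variable
    k n : ℕ
    x x′ : Carrierᴹ

  infixr 7 y^[_]_
  y^[_]_ : ℕ → Carrierᴹ → Carrierᴹ
  y^[ zero ]  x = x
  y^[ suc n ] x = y *ₗ y^[ n ] x

  y^-+ : ∀ a b x → y^[ a + b ] x ≡ y^[ a ] y^[ b ] x
  y^-+ zero    b x = ≡.refl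
  y^-+ (suc a) b x = ≡.cong (y *ₗ_) (y^-+ a b x)

  y^-comm : ∀ a b x → y^[ a ] y^[ b ] x ≡ y^[ b ] y^[ a ] x
  y^-comm a b x = ≡.trans (≡.sym (y^-+ a b x)) (≡.trans (≡.cong (y^[_] x) (+-comm a b)) (y^-+ b a x))

  y^-cong : ∀ n → x ≈ᴹ x′ → y^[ n ] x ≈ᴹ y^[ n ] x′
  y^-cong zero    x≈x′ = x≈x′
  y^-cong (suc n) x≈x′ = *ₗ-congˡ (y^-cong n x≈x′)

  y^-0ᴹ : ∀ n → y^[ n ] 0ᴹ ≈ᴹ 0ᴹ
  y^-0ᴹ zero    = ≈ᴹ-refl
  y^-0ᴹ (suc n) = ≈ᴹ-trans (*ₗ-congˡ (y^-0ᴹ n)) (*ₗ-zeroʳ y)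

  y^-+ᴹ : ∀ n x x′ → y^[ n ] (x +ᴹ x′) ≈ᴹ y^[ n ] x +ᴹ y^[ n ] x′
  y^-+ᴹ zero    x x′ = ≈ᴹ-refl
  y^-+ᴹ (suc n) x x′ = ≈ᴹ-trans (*ₗ-congˡ (y^-+ᴹ n x x′)) (*ₗ-distribˡ y _ _)

  y^-neg : ∀ n x → y^[ n ] (-ᴹ x) ≈ᴹ -ᴹ (y^[ n ] x)
  y^-neg zero    x = ≈ᴹ-refl
  y^-neg (suc n) x = ≈ᴹ-trans (*ₗ-congˡ (y^-neg n x)) (*ₗ-neg M y _)

  data Span : Carrierᴹ → Set (i ⊔ m ⊔ ℓm) where
    span-gen : ∀ ι → Span (g ι)
    span-0ᴹ  : Span 0ᴹ
    span-+ᴹ  : Span x → Span x′ → Span (x +ᴹ x′)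
    span-neg : Span x → Span (-ᴹ x)
    span-y   : Span x → Span (y *ₗ x)

  record Layer (n : ℕ) (x : Carrierᴹ) : Set (i ⊔ m ⊔ ℓm) where
    constructor layer
    field
      {root}  : Carrierᴹ
      root∈   : Span root
      ≈y^root : x ≈ᴹ y^[ n ] root

  Layer-resp : x ≈ᴹ x′ → Layer n x → Layer n x′
  Layer-resp x≈x′ (layer h∈ x≈) = layer h∈ (≈ᴹ-trans (≈ᴹ-sym x≈x′) x≈)

  y^-Layer : ∀ n {h} → Span h → Layer n (y^[ n ] h)
  y^-Layer n h∈ = layer h∈ ≈ᴹ-refl

  Layer-0ᴹ : Layer n 0ᴹ
  Layer-0ᴹ {n} = Layer-resp (y^-0ᴹ n) (y^-Layer n span-0ᴹ)

  Layer-+ᴹ : Layer n x → Layer n x′ → Layer n (x +ᴹ x′)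
  Layer-+ᴹ {n} (layer h∈ x≈) (layer h′∈ x′≈) =
    layer (span-+ᴹ h∈ h′∈) (≈ᴹ-trans (+ᴹ-cong x≈ x′≈) (≈ᴹ-sym (y^-+ᴹ n _ _)))

  Layer-neg : Layer n x → Layer n (-ᴹ x)
  Layer-neg {n} (layer h∈ x≈) = layer (span-neg h∈) (≈ᴹ-trans (-ᴹ‿cong x≈) (≈ᴹ-sym (y^-neg n _)))

  Layer-y : Layer n x → Layer (suc n) (y *ₗ x)
  Layer-y (layer h∈ x≈) = layer h∈ (*ₗ-congˡ x≈)

  Layer-suc : Layer (suc n) x → Layer n x
  Layer-suc {n} (layer h∈ x≈) = layer (span-y h∈) (≈ᴹ-trans x≈ (≈ᴹ-reflexive (y^-comm 1 n _)))

  Layer-y^ : ∀ e → Layer n x → Layer n (y^[ e ] x)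
  Layer-y^ zero    x∈ = x∈
  Layer-y^ (suc e) x∈ = Layer-suc (Layer-y (Layer-y^ e x∈))

  Layer-chain : IsDescendingChain +ᴹ-abelianGroup Layer
  Layer-chain = record
    { P-resp = Layer-resp
    ; P-ε    = Layer-0ᴹ
    ; P-∙    = Layer-+ᴹ
    ; P-⁻¹   = Layer-neg
    ; P-suc  = Layer-suc
    }

  Stable : ℕ → Set (i ⊔ m ⊔ ℓm)
  Stable k = ∀ {x} → Layer k x → Layer (suc k) x

  Stable-suc : Stable k → Stable (suc k)
  Stable-suc {k} stable (layer h∈ x≈) =
    Layer-resp (≈ᴹ-sym x≈) (Layer-y (stable (y^-Layer k h∈)))

  Stable-+ : Stable k → ∀ e → Stable (e + k)
  Stable-+ stable zero    = stable
  Stable-+ stable (suc e) = Stable-suc (Stable-+ stable e)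

  Stable⇒Layer-+ : Stable k → ∀ e → Layer k x → Layer (e + k) x
  Stable⇒Layer-+ stable zero    x∈ = x∈
  Stable⇒Layer-+ stable (suc e) x∈ = Stable-+ stable e (Stable⇒Layer-+ stable e x∈)

  generators⇒Stable : (∀ ι → Layer (suc k) (y^[ k ] g ι)) → Stable k
  generators⇒Stable {k} gens (layer h∈ x≈) = Layer-resp (≈ᴹ-sym x≈) (lift h∈)
    where
    lift : ∀ {h} → Span h → Layer (suc k) (y^[ k ] h)
    lift (span-gen ι)     = gens ι
    lift span-0ᴹ          = Layer-resp (≈ᴹ-sym (y^-0ᴹ k)) Layer-0ᴹ
    lift (span-+ᴹ h∈ h′∈) = Layer-resp (≈ᴹ-sym (y^-+ᴹ k _ _)) (Layer-+ᴹ (lift h∈) (lift h′∈))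
    lift (span-neg h∈)    = Layer-resp (≈ᴹ-sym (y^-neg k _)) (Layer-neg (lift h∈))
    lift (span-y {x = h} h∈) =
      Layer-resp (≈ᴹ-reflexive (y^-comm 1 k h)) (Layer-y^ 1 (lift h∈))

module GrouplessSubgroup {r ℓr m ℓm g : Level} (R : Ring r ℓr) (F : Ring.Carrier R)
  (M : LeftModule R m ℓm) (G : LeftModule.Carrierᴹ M → Set g)
  (G-subgroup : IsSubgroup F M G) (groupless : IsGrouplessFSet F M G) where

  open LeftModule M
  open IsSubgroup G-subgroup
  open import Algebra.Properties.AbelianGroup +ᴹ-abelianGroup using (\\-leftDividesʳ; //-rightDividesˡ)

  t : ℕ
  t = proj₁ groupless

  b : Fin t → Carrierᴹ
  b = proj₁ (proj₂ groupless)

  D : Fin t → BasicData F M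
  D = proj₁ (proj₂ (proj₂ groupless))

  G⇔⋃ : ∀ x → G x ⇔ (Σ[ j ∈ Fin t ] Σ[ s ∈ Carrierᴹ ] InBasic F M (D j) s × x ≈ᴹ b j +ᴹ s)
  G⇔⋃ = proj₂ (proj₂ (proj₂ groupless))

  len : Fin t → ℕ
  len j = BasicData.n (D j)

  δ : (j : Fin t) → Fin (len j) → ℕ
  δ j = BasicData.δ (D j)

  a : (j : Fin t) → Fin (len j) → Carrierᴹ
  a j = BasicData.a (D j)

  term : (j : Fin t) → Fin (len j) → Maybe ℕ → Carrierᴹ
  term j i e = fTerm F M (δ j i) e (a j i)

  δ≢0 : ∀ j i → NonZero (δ j i)
  δ≢0 j i = >-nonZero (BasicData.δ-pos (D j) i)

  Δ-spec : Σ[ Δ ∈ ℕ ] NonZero Δ × (∀ j i → δ j i ∣ Δ)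
  Δ-spec =
    let Δ , Δ≢0 , Δⱼ∣Δ = common-multiple (λ j → proj₁ (Δⱼ j)) (λ j → proj₁ (proj₂ (Δⱼ j)))
    in Δ , Δ≢0 , λ j i → ∣-trans (proj₂ (proj₂ (Δⱼ j)) i) (Δⱼ∣Δ j)
    where
    Δⱼ : ∀ j → Σ[ Δⱼ ∈ ℕ ] NonZero Δⱼ × (∀ i → δ j i ∣ Δⱼ)
    Δⱼ j = common-multiple (δ j) (δ≢0 j)

  Δ : ℕ
  Δ = proj₁ Δ-spec

  instance
    Δ≢0 : NonZero Δ
    Δ≢0 = proj₁ (proj₂ Δ-spec)

  q : (j : Fin t) → Fin (len j) → ℕ
  q j i = _∣_.quotient (proj₂ (proj₂ Δ-spec) j i)

  Δ≡q*δ : ∀ j i → Δ ≡ q j i * δ j i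
  Δ≡q*δ j i = m∣n⇒n≡quotient*m (proj₂ (proj₂ Δ-spec) j i)

  q≢0 : ∀ j i → NonZero (q j i)
  q≢0 j i = quotient≢0 (proj₂ (proj₂ Δ-spec) j i)

  q≤Δ : ∀ j i → q j i ≤ Δ
  q≤Δ j i = ≡.subst (q j i ≤_) (≡.sym (Δ≡q*δ j i)) (m≤m*n (q j i) (δ j i) {{δ≢0 j i}})

  y : Ring.Carrier R
  y = pow R F Δ

  Generator : Set
  Generator = Σ (Fin t) λ j → Fin (len j) × ℕ

  gen : (j : Fin t) → Fin (len j) → ℕ → Carrierᴹ
  gen j i k = term j i (just k)

  generator : Generator → Carrierᴹ
  generator (j , i , k) = gen j i k

  open CyclicSpan M y generator public
  open DescendingChain +ᴹ-abelianGroup Layer-chain public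
  open import Relation.Binary.Reasoning.Setoid ≈ᴹ-setoid

  y^-pow : ∀ n u → y^[ n ] u ≈ᴹ pow R F (n * Δ) *ₗ u
  y^-pow zero    u = ≈ᴹ-sym (*ₗ-identityˡ u)
  y^-pow (suc n) u = ≈ᴹ-trans (*ₗ-congˡ (y^-pow n u)) (≈ᴹ-sym (pow-+-*ₗ M F Δ (n * Δ) u))

  y^-gen : ∀ j i e k → y^[ e ] gen j i k ≈ᴹ gen j i (k + e * q j i)
  y^-gen j i e k = begin
    y^[ e ] (pow R F (δ j i * k) *ₗ a j i)            ≈⟨ y^-pow e _ ⟩
    pow R F (e * Δ) *ₗ (pow R F (δ j i * k) *ₗ a j i)  ≈⟨ pow-+-*ₗ M F (e * Δ) (δ j i * k) (a j i) ⟨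
    pow R F (e * Δ + δ j i * k) *ₗ a j i              ≡⟨ ≡.cong (λ n → pow R F n *ₗ a j i) exponents ⟩
    pow R F (δ j i * (k + e * q j i)) *ₗ a j i        ∎
    where
    open +-*-Solver
    exponents : e * Δ + δ j i * k ≡ δ j i * (k + e * q j i)
    exponents = ≡.trans (≡.cong (λ Δ → e * Δ + δ j i * k) (Δ≡q*δ j i))
      (solve 4 (λ e q d k → e :* (q :* d) :+ d :* k := d :* (k :+ e :* q)) ≡.refl e (q j i) (δ j i) k)

  G⇐ : ∀ j {s} → InBasic F M (D j) s → G (b j +ᴹ s)
  G⇐ j s∈ = Equivalence.from (G⇔⋃ _) (j , _ , s∈ , ≈ᴹ-refl)

  b∈G : ∀ j → G (b j)
  b∈G j = resp (+ᴹ-identityʳ (b j)) (G⇐ j ((λ _ → nothing) , ≈ᴹ-sym (sumᴹ-0ᴹ F M (len j))))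

  basic⊆G : ∀ j {s} → InBasic F M (D j) s → G s
  basic⊆G j {s} s∈ = resp (\\-leftDividesʳ (b j) s) (+-closed (neg-closed (b∈G j)) (G⇐ j s∈))

  generator∈G : ∀ ι → G (generator ι)
  generator∈G (j , i , k) =
    basic⊆G j (single F M i k , ≈ᴹ-sym (sumᴹ-single F M (term j) (λ _ → ≈ᴹ-refl) i k))

  Span⊆G : ∀ {h} → Span h → ∀ n → G (y^[ n ] h)
  Span⊆G (span-gen (j , i , k)) n = resp (≈ᴹ-sym (y^-gen j i n k)) (generator∈G (j , i , _))
  Span⊆G span-0ᴹ               n = resp (≈ᴹ-sym (y^-0ᴹ n)) has-0
  Span⊆G (span-+ᴹ h∈ h′∈)       n = resp (≈ᴹ-sym (y^-+ᴹ n _ _)) (+-closed (Span⊆G h∈ n) (Span⊆G h′∈ n))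
  Span⊆G (span-neg h∈)          n = resp (≈ᴹ-sym (y^-neg n _)) (neg-closed (Span⊆G h∈ n))
  Span⊆G (span-y {x = h} h∈)   n = resp (≈ᴹ-reflexive (y^-comm 1 n h)) (Span⊆G h∈ (suc n))

  Layer₀⊆G : ∀ {x} → Layer 0 x → G x
  Layer₀⊆G (layer h∈ x≈) = resp (≈ᴹ-sym x≈) (Span⊆G h∈ 0)

  generators-mod-y : ∀ {k} → (∀ j i (r : Fin (q j i)) → Layer (suc k) (y^[ k ] gen j i (toℕ r))) →
                     ∀ ι → Layer (suc k) (y^[ k ] generator ι)
  generators-mod-y {k} base (j , i , n) = Layer-resp shift (Layer-y^ (n / q j i) (base j i residue))
    where
    instance
      qⱼᵢ≢0 : NonZero (q j i)
      qⱼᵢ≢0 = q≢0 j i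
    residue : Fin (q j i)
    residue = fromℕ< (m%n<n n (q j i))
    division : toℕ residue + n / q j i * q j i ≡ n
    division = ≡.trans (≡.cong (_+ n / q j i * q j i) (toℕ-fromℕ< _)) (≡.sym (m≡m%n+[m/n]*n n (q j i)))
    shift : y^[ n / q j i ] y^[ k ] gen j i (toℕ residue) ≈ᴹ y^[ k ] gen j i n
    shift = begin
      y^[ n / q j i ] y^[ k ] gen j i (toℕ residue)       ≡⟨ y^-comm (n / q j i) k _ ⟩
      y^[ k ] y^[ n / q j i ] gen j i (toℕ residue)       ≈⟨ y^-cong k (y^-gen j i (n / q j i) _) ⟩
      y^[ k ] gen j i (toℕ residue + n / q j i * q j i)   ≡⟨ ≡.cong (λ m → y^[ k ] gen j i m) division ⟩
      y^[ k ] gen j i n                                   ∎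

  y^-divisible : ∀ n u → ∃[ z ] y^[ n ] u ≈ᴹ pow R F n *ₗ z
  y^-divisible n u = pow R F (n * Δ ∸ n) *ₗ u , (begin
    y^[ n ] u                                  ≈⟨ y^-pow n u ⟩
    pow R F (n * Δ) *ₗ u                        ≡⟨ ≡.cong (λ e → pow R F e *ₗ u) (m+[n∸m]≡n (m≤m*n n Δ)) ⟨
    pow R F (n + (n * Δ ∸ n)) *ₗ u              ≈⟨ pow-+-*ₗ M F n (n * Δ ∸ n) u ⟩
    pow R F n *ₗ (pow R F (n * Δ ∸ n) *ₗ u)     ∎)

  Stable⇒⋂Fⁿ : ∀ {k x} → Stable k → Layer k x → InAllFPowers F M x
  Stable⇒⋂Fⁿ {k} stable x∈ n =
    let open Layer (Stable⇒Layer-+ stable n x∈)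
        z , y^root≈ = y^-divisible n (y^[ k ] root)
    in z , ≈ᴹ-trans ≈y^root (≈ᴹ-trans (≈ᴹ-reflexive (y^-+ n k root)) y^root≈)

  sumᴹ-∼ : ∀ {n} k {f f′ : Fin k → Carrierᴹ} → (∀ i → f i ∼[ n ] f′ i) → sumᴹ F M k f ∼[ n ] sumᴹ F M k f′
  sumᴹ-∼ zero    f∼f′ = ∼-refl
  sumᴹ-∼ (suc k) f∼f′ = ∼-∙ (f∼f′ zero) (sumᴹ-∼ k (λ i → f∼f′ (suc i)))

  W : ℕ
  W = proj₁ (upper-bound len)

  len≤W : ∀ j → len j ≤ W
  len≤W = proj₂ (upper-bound len)

  B : ℕ → ℕ
  B n = suc (n * Δ)

  exponent : ∀ {K} → Fin (suc K) → Maybe ℕ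
  exponent zero    = nothing
  exponent (suc k) = just (toℕ k)

  truncate : ∀ n j i → Maybe ℕ → Fin (B n)
  truncate n j i nothing  = zero
  truncate n j i (just k) with k <? n * q j i
  ... | yes k<nq = suc (fromℕ< (<-≤-trans k<nq (*-monoʳ-≤ n (q≤Δ j i))))
  ... | no  _    = zero

  term∼truncate : ∀ n j i e → term j i e ∼[ n ] term j i (exponent (truncate n j i e))
  term∼truncate n j i nothing = ∼-refl
  term∼truncate n j i (just k) with k <? n * q j i
  ... | yes k<nq = ∼-resp ≈ᴹ-refl (≈ᴹ-reflexive (≡.cong (gen j i) (≡.sym (toℕ-fromℕ< _)))) ∼-refl
  ... | no  k≮nq = ∈⇒∼ε (Layer-resp y^gen≈gen (y^-Layer n (span-gen (j , i , k ∸ n * q j i))))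
    where
    y^gen≈gen : y^[ n ] gen j i (k ∸ n * q j i) ≈ᴹ gen j i k
    y^gen≈gen = ≈ᴹ-trans (y^-gen j i n _) (≈ᴹ-reflexive (≡.cong (gen j i) (m∸n+n≡m (≮⇒≥ k≮nq))))

  representative : ∀ n → Fin t → (Fin W → Fin (B n)) → Carrierᴹ
  representative n j v = b j +ᴹ sumᴹ F M (len j) λ i → term j i (exponent (v (inject≤ i (len≤W j))))

  Code : ℕ → ℕ
  Code n = t * B n ^ W

  decode : ∀ n → Fin (Code n) → Carrierᴹ
  decode n c = representative n (quotient {t} (B n ^ W) c) (finToFun (remainder {t} (B n ^ W) c))

  decode-combine : ∀ n j v → decode n (combine j (funToFin v)) ≈ᴹ representative n j v
  decode-combine n j v = ≈ᴹ-trans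
    (≈ᴹ-reflexive (≡.cong (λ (j , c) → representative n j (finToFun c)) (remQuot-combine j (funToFin v))))
    (+ᴹ-congˡ (sumᴹ-cong F M (len j) λ i →
      ≈ᴹ-reflexive (≡.cong (λ c → term j i (exponent c)) (finToFun-funToFin v _))))

  cover : ∀ n → CosetCover G n (Code n)
  cover n = decode n , λ {x} x∈G →
    let j , s , (e , s≈) , x≈ = Equivalence.to (G⇔⋃ x) x∈G
        v = padTo (len≤W j) zero (λ i → truncate n j i (e i))
        s∼ : s ∼[ n ] sumᴹ F M (len j) λ i → term j i (exponent (v (inject≤ i (len≤W j))))
        s∼ = ∼-resp (≈ᴹ-sym s≈) ≈ᴹ-refl (sumᴹ-∼ (len j) λ i →
               ≡.subst (λ c → term j i (e i) ∼[ n ] term j i (exponent c))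
                       (≡.sym (padTo-inject≤ (len≤W j) zero _ i)) (term∼truncate n j i (e i)))
    in combine j (funToFin v) , ∼-resp (≈ᴹ-sym x≈) (≈ᴹ-sym (decode-combine n j v)) (∼-∙ ∼-refl s∼)

  cover-Layer₀ : ∀ n → CosetCover (Layer 0) n (Code n)
  cover-Layer₀ n = proj₁ (cover n) , λ x∈ → proj₂ (cover n) (Layer₀⊆G x∈)

  Stable⇒finite : ∀ {k} → Stable k → FiniteSubset F M (InAllFPowers F M) → FiniteSubset F M G
  Stable⇒finite {k} stable ⋂Fⁿ-finite =
    FiniteSubset-+ F M ⋂Fⁿ-finite (image-finite F M (proj₁ (cover k))) λ x x∈G →
      let rep = proj₁ (cover k)
          c , x∼ = proj₂ (cover k) x∈G
      in x +ᴹ -ᴹ rep c , rep c , Stable⇒⋂Fⁿ stable x∼ , (c , ≈ᴹ-refl) , ≈ᴹ-sym (//-rightDividesˡ (rep c) x)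

  gap : FiniteSubset F M (InAllFPowers F M) → Infinite F M G → ∀ k → ¬ ¬ Gap k
  gap ⋂Fⁿ-finite G-infinite k no-gap =
    ¬¬-∀Fin (λ j → ¬¬-∀Fin λ i → ¬¬-∀Fin λ r → no-gap-at j i r) λ generators-stable →
      G-infinite (Stable⇒finite (generators⇒Stable (generators-mod-y generators-stable)) ⋂Fⁿ-finite)
    where
    no-gap-at : ∀ j i (r : Fin (q j i)) → ¬ ¬ Layer (suc k) (y^[ k ] gen j i (toℕ r))
    no-gap-at j i r ∉ = no-gap (_ , y^-Layer k (span-gen (j , i , toℕ r)) , ∉)

lemma5p8 : {r ℓr m ℓm g : Level} (R : Ring r ℓr) (F : Ring.Carrier R) →
    GeneratedBy R F →
    (M : LeftModule R m ℓm) → IsFSpace F M →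
    (G : LeftModule.Carrierᴹ M → Set g) → IsSubgroup F M G → Infinite F M G →
    ¬ IsGrouplessFSet F M G
lemma5p8 R F _ M (_ , ⋂Fⁿ-finite) G G-subgroup G-infinite groupless =
  ¬¬-gaps (gap ⋂Fⁿ-finite G-infinite) 0 n λ gaps →
    <⇒≱ Code<2ⁿ (gaps⇒2^n≤cover gaps (cover-Layer₀ n))
  where
  open GrouplessSubgroup R F M G G-subgroup groupless
  n : ℕ
  n = proj₁ (polynomial<2^ t Δ W)
  Code<2ⁿ : Code n < 2 ^ n
  Code<2ⁿ = proj₂ (polynomial<2^ t Δ W)
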